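{- Let $m \geq 3$ be an integer, let $\mathcal{A}$ be a finite set with a strict linear order $<$, and let $\mathcal{B}$ be a weakly $(m-1)$-wise balanced design over $\mathcal{A}$. Then the chromatic number satisfies $\chi(\Gamma_{\mathcal{B}, m}) \geq \frac{\sum_{B \in \mathcal{B}}|B|}{|\mathcal{A}| + |\mathcal{B}|}$.
   Context: For an integer $r \geq 2$ and a set $\mathcal{A}$ (whose elements are called points), a weakly $r$-wise balanced design over $\mathcal{A}$ is a family $\mathcal{B}$ of subsets of $\mathcal{A}$ (called blocks) such that: (1) any $r$ pairwise distinct points are contained together in at most one block; (2) every point lies in at least one block; (3) every block is non-empty. Given $m \geq 3$, a weakly $(m-1)$-wise balanced design $\mathcal{B}$ over $\mathcal{A}$, and a strict linear order $<$ on $\mathcal{A}$, the graph $\Gamma_{\mathcal{B}, m}$ has as vertices all incidence pairs $(x, B)$ with $B \in \mathcal{B}$ and $x \in B$; two vertices $(x, B_1)$ and $(y, B_2)$ are adjacent iff $x < y$, $B_1 \neq B_2$, and $x \in B_2$. -}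

module Defs where

open import Data.Nat using (ℕ; _*_; _+_; _≥_)
open import Data.Fin using (Fin; _<_)
open import Data.Fin.Subset using (Subset; _∈_; _⊆_; ∣_∣; Nonempty)
open import Data.List using (map; allFin)
open import Data.Nat.ListAction using (sum)
open import Data.Product using (Σ; ∃; _×_; _,_)
open import Relation.Binary.PropositionalEquality using (_≡_; _≢_)
open import Function.Definitions using (Injective)

-- Points: Fin n, ordered by the standard strict order _<_ on Fin n.
-- Blocks: an injective family B : Fin b → Subset n (so the blocks form a set
-- of b distinct subsets of the points).

record WeaklyBalanced (r n b : ℕ) (B : Fin b → Subset n) : Set where
  field
    distinctBlocks : Injective _≡_ _≡_ B
    atMostOne : ∀ (S : Subset n) → ∣ S ∣ ≡ r →
                ∀ i j → S ⊆ B i → S ⊆ B j → i ≡ j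
    covers : ∀ (x : Fin n) → ∃ λ i → x ∈ B i
    nonempty : ∀ i → Nonempty (B i)

Vertex : ∀ {n b} → (Fin b → Subset n) → Set
Vertex {n} {b} B = Σ (Fin n × Fin b) λ { (x , i) → x ∈ B i }

-- Adjacency (one orientation; the graph is its symmetric closure):
-- (x , B_i) ~ (y , B_j) iff x < y, B_i ≠ B_j, and x ∈ B_j.
Adj : ∀ {n b} (B : Fin b → Subset n) → Vertex B → Vertex B → Set
Adj B ((x , i) , _) ((y , j) , _) = (x < y) × (i ≢ j) × (x ∈ B j)

ProperColouring : ∀ {n b} (B : Fin b → Subset n) (k : ℕ) → (Vertex B → Fin k) → Set
ProperColouring B k c = ∀ v w → Adj B v w → c v ≢ c w

totalSize : ∀ {n b} → (Fin b → Subset n) → ℕ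
totalSize {n} {b} B = sum (map (λ i → ∣ B i ∣) (allFin b))

{-# OPTIONS --safe #-}
module Submission where

-- A vertex (x , B) of colour a is labelled (a , x) if some later point y of B has
-- (y , B) of colour a as well, and (a , B) otherwise. Labelling is injective: two
-- vertices labelled (a , x) in blocks B₁ ≠ B₂ cannot exist, since (x , B₂) would be
-- adjacent to the later (y , B₁) of the same colour; and two vertices labelled
-- (a , B) are both the last vertex of colour a in B. So the Σ|B| vertices fit into
-- k (|A| + |B|) labels.

open import Defs
open import Data.Nat as ℕ using (ℕ; _*_; _+_; _≥_; _∸_)
open import Data.Nat.ListAction using (sum)
open import Data.Nat.Properties using (module ≤-Reasoning)
open import Data.Fin using (Fin; zero; suc; splitAt; _↑ˡ_; _↑ʳ_; _<_)
open import Data.Fin.Properties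
  using (_≟_; _<?_; <-cmp; suc-injective; any?; splitAt⁻¹-↑ˡ; splitAt⁻¹-↑ʳ; injective⇒≤; *↔×; +↔⊎)
open import Data.Fin.Subset using (Subset; _∈_; inside; outside; ∣_∣)
open import Data.Fin.Subset.Properties using (_∈?_)
open import Data.Vec using (_∷_; here; there)
open import Data.Vec.Properties.WithK using ([]=-irrelevant)
open import Data.List using (map; allFin; tabulate)
open import Data.List.Properties using (map-tabulate)
open import Data.Product using (Σ; ∃; _×_; _,_; proj₁; proj₂)
open import Data.Product.Properties using (,-injectiveˡ; ,-injectiveʳ)
open import Data.Product.Function.NonDependent.Propositional using (_×-↔_)
open import Data.Sum using (_⊎_; inj₁; inj₂)
open import Data.Sum.Properties using (inj₁-injective; inj₂-injective)
open import Data.Empty using (⊥-elim)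
open import Function using (_∘_; id; _∋_)
open import Function.Bundles using (_↣_; mk↣; Injection)
open import Function.Construct.Composition using (_↣-∘_)
open import Function.Definitions using (Injective)
open import Function.Properties.Inverse using (↔⇒↣; ↔-sym; ↔-trans; ↔-refl)
open import Relation.Binary using (tri<; tri≈; tri>)
open import Relation.Binary.PropositionalEquality using (_≡_; refl; sym; trans; cong; module ≡-Reasoning)
open import Relation.Nullary using (Dec; yes; no; ¬_; contradiction)
open import Relation.Nullary.Decidable using (map′; _×-dec_)

sum-map-allFin : ∀ {b} (f : Fin b → ℕ) → sum (map f (allFin b)) ≡ sum (tabulate f)
sum-map-allFin f = cong sum (map-tabulate id f)

splitSum : ∀ {b} (f : Fin b → ℕ) → Fin (sum (tabulate f)) → Σ (Fin b) (Fin ∘ f)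
splitSum {ℕ.suc b} f s with splitAt (f zero) s
... | inj₁ j = zero , j
... | inj₂ t = let (i , j) = splitSum (f ∘ suc) t in suc i , j

joinSum : ∀ {b} (f : Fin b → ℕ) → Σ (Fin b) (Fin ∘ f) → Fin (sum (tabulate f))
joinSum f (zero  , j) = j ↑ˡ _
joinSum f (suc i , j) = f zero ↑ʳ joinSum (f ∘ suc) (i , j)

joinSum-splitSum : ∀ {b} (f : Fin b → ℕ) (s : Fin (sum (tabulate f))) → joinSum f (splitSum f s) ≡ s
joinSum-splitSum {ℕ.suc b} f s with splitAt (f zero) s in eq
... | inj₁ j = splitAt⁻¹-↑ˡ eq
... | inj₂ t = trans (cong (f zero ↑ʳ_) (joinSum-splitSum (f ∘ suc) t)) (splitAt⁻¹-↑ʳ eq)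

sum↣Σ : ∀ {b} (f : Fin b → ℕ) → Fin (sum (tabulate f)) ↣ Σ (Fin b) (Fin ∘ f)
sum↣Σ f = mk↣ {to = splitSum f} λ {s} {t} e → begin
  s                          ≡⟨ sym (joinSum-splitSum f s) ⟩
  joinSum f (splitSum f s)   ≡⟨ cong (joinSum f) e ⟩
  joinSum f (splitSum f t)   ≡⟨ joinSum-splitSum f t ⟩
  t                          ∎
  where open ≡-Reasoning

enumerate : ∀ {n} (p : Subset n) → Fin ∣ p ∣ → Σ (Fin n) (_∈ p)
enumerate (inside  ∷ p) zero    = zero , here
enumerate (inside  ∷ p) (suc j) = let (x , x∈p) = enumerate p j in suc x , there x∈p
enumerate (outside ∷ p) j       = let (x , x∈p) = enumerate p j in suc x , there x∈p

enumerate-injective : ∀ {n} (p : Subset n) → Injective _≡_ _≡_ (proj₁ ∘ enumerate p)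
enumerate-injective (inside  ∷ p) {zero}  {zero}  e = refl
enumerate-injective (inside  ∷ p) {suc i} {suc j} e = cong suc (enumerate-injective p (suc-injective e))
enumerate-injective (outside ∷ p)                 e = enumerate-injective p (suc-injective e)

module _ {n b : ℕ} {B : Fin b → Subset n} where

  vertex-≡ : ∀ {x i} (p q : x ∈ B i) → (Vertex B ∋ ((x , i) , p)) ≡ ((x , i) , q)
  vertex-≡ p q = cong (_ ,_) ([]=-irrelevant p q)

  vertexAt : Σ (Fin b) (λ i → Fin ∣ B i ∣) → Vertex B
  vertexAt (i , j) = let (x , x∈Bi) = enumerate (B i) j in (x , i) , x∈Bi

  Σ↣Vertex : Σ (Fin b) (λ i → Fin ∣ B i ∣) ↣ Vertex B
  Σ↣Vertex = mk↣ injective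
    where
    injective : Injective _≡_ _≡_ vertexAt
    injective {i , j} e with refl ← cong (proj₂ ∘ proj₁) e =
      cong (i ,_) (enumerate-injective (B i) (cong (proj₁ ∘ proj₁) e))

  totalSize↣Vertex : Fin (sum (tabulate (∣_∣ ∘ B))) ↣ Vertex B
  totalSize↣Vertex = Σ↣Vertex ↣-∘ sum↣Σ (∣_∣ ∘ B)

module _ {n b k : ℕ} {B : Fin b → Subset n} {c : Vertex B → Fin k}
         (proper : ProperColouring B k c) where

  ColourRecursLater : Vertex B → Set
  ColourRecursLater v@((x , i) , _) =
    ∃ λ y → x < y × Σ (y ∈ B i) λ y∈Bi → c ((y , i) , y∈Bi) ≡ c v

  colourRecursLater? : ∀ v → Dec (ColourRecursLater v)
  colourRecursLater? v@((x , i) , _) = any? λ y → (x <? y) ×-dec sameColourAt y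
    where
    sameColourAt : ∀ y → Dec (Σ (y ∈ B i) λ y∈Bi → c ((y , i) , y∈Bi) ≡ c v)
    sameColourAt y with y ∈? B i
    ... | no  y∉Bi = no (y∉Bi ∘ proj₁)
    ... | yes y∈Bi = map′ (y∈Bi ,_)
                          (λ (y∈Bi′ , e) → trans (cong (λ q → c ((y , i) , q)) ([]=-irrelevant y∈Bi y∈Bi′)) e)
                          (c ((y , i) , y∈Bi) ≟ c v)

  recurring-samePoint⇒sameBlock : ∀ {x i j} {p : x ∈ B i} {q : x ∈ B j} →
    ColourRecursLater ((x , i) , p) → c ((x , i) , p) ≡ c ((x , j) , q) → i ≡ j
  recurring-samePoint⇒sameBlock {x} {i} {j} {p} {q} (z , x<z , z∈Bi , cz≡cv) cv≡cw with i ≟ j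
  ... | yes i≡j = i≡j
  ... | no  i≢j = ⊥-elim (proper ((x , j) , q) ((z , i) , z∈Bi) (x<z , i≢j ∘ sym , p)
                                 (sym (trans cz≡cv cv≡cw)))

  lastOfColour-sameBlock⇒samePoint : ∀ {x y i} {p : x ∈ B i} {q : y ∈ B i} →
    ¬ ColourRecursLater ((x , i) , p) → ¬ ColourRecursLater ((y , i) , q) →
    c ((x , i) , p) ≡ c ((y , i) , q) → x ≡ y
  lastOfColour-sameBlock⇒samePoint {x} {y} {p = p} {q} ¬rv ¬rw cv≡cw with <-cmp x y
  ... | tri< x<y _ _ = ⊥-elim (¬rv (y , x<y , q , sym cv≡cw))
  ... | tri≈ _ x≡y _ = x≡y
  ... | tri> _ _ y<x = ⊥-elim (¬rw (x , y<x , p , cv≡cw))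

  label : Vertex B → Fin k × (Fin n ⊎ Fin b)
  label v@((x , i) , _) with colourRecursLater? v
  ... | yes _ = c v , inj₁ x
  ... | no  _ = c v , inj₂ i

  label-injective : Injective _≡_ _≡_ label
  label-injective {v@((x , i) , p)} {w@((y , j) , q)} e
    with colourRecursLater? v | colourRecursLater? w
  ... | yes rv | yes _ with refl ← inj₁-injective (,-injectiveʳ e)
                       with refl ← recurring-samePoint⇒sameBlock rv (,-injectiveˡ e) = vertex-≡ p q
  ... | no ¬rv | no ¬rw with refl ← inj₂-injective (,-injectiveʳ e)
                        with refl ← lastOfColour-sameBlock⇒samePoint ¬rv ¬rw (,-injectiveˡ e) = vertex-≡ p q
  ... | yes _  | no  _ = contradiction (,-injectiveʳ e) λ ()
  ... | no  _  | yes _ = contradiction (,-injectiveʳ e) λ ()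

  Vertex↣labels : Vertex B ↣ (Fin k × (Fin n ⊎ Fin b))
  Vertex↣labels = mk↣ label-injective

labels↣Fin : ∀ {k n b} → (Fin k × (Fin n ⊎ Fin b)) ↣ Fin (k * (n + b))
labels↣Fin = ↔⇒↣ (↔-sym (↔-trans *↔× (↔-refl ×-↔ +↔⊎)))

theorem2p5 : ∀ (m n b : ℕ) → m ≥ 3 → (B : Fin b → Subset n) →
               WeaklyBalanced (m ∸ 1) n b B →
               ∀ (k : ℕ) (c : Vertex B → Fin k) → ProperColouring B k c →
               k * (n + b) ≥ totalSize B
theorem2p5 _ n b _ B _ k _ proper = begin
  totalSize B                   ≡⟨ sum-map-allFin (∣_∣ ∘ B) ⟩
  sum (tabulate (∣_∣ ∘ B))      ≤⟨ injective⇒≤ (Injection.injective vertexLabelling) ⟩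
  k * (n + b)                   ∎
  where
  open ≤-Reasoning
  vertexLabelling : Fin (sum (tabulate (∣_∣ ∘ B))) ↣ Fin (k * (n + b))
  vertexLabelling = labels↣Fin ↣-∘ (Vertex↣labels proper ↣-∘ totalSize↣Vertex)
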